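{- For integers $d$ and $\ell$ with $2\leq\ell\leq d$, there exists a constant $C=C(\ell)$ such that the following holds. Let $A_1,\ldots,A_\ell,A_{\ell+1}\subseteq\mathbb{F}_q^d$ and let $S\subseteq\prod_{i=1}^{\ell+1}A_i$ with $|S|\sim\prod_{i=1}^{\ell+1}|A_i|$. Define $$S'=\{(x_1,\ldots,x_\ell)\in\textstyle\prod_{i=1}^\ell A_i:(x_1,\ldots,x_\ell,x_{\ell+1})\in S\text{ for some }x_{\ell+1}\in A_{\ell+1}\},$$ and for $(x_1,\ldots,x_\ell)\in S'$ define $S(x_1,\ldots,x_\ell)=\{x_{\ell+1}\in A_{\ell+1}:(x_1,\ldots,x_\ell,x_{\ell+1})\in S\}$ and $$\Pi_{x_1,\ldots,x_\ell}(S(x_1,\ldots,x_\ell))=\{(x_1\cdot x_{\ell+1},\ldots,x_\ell\cdot x_{\ell+1})\in\mathbb{F}_q^\ell: x_{\ell+1}\in S(x_1,\ldots,x_\ell)\}.$$ If $|A_i||A_{\ell+1}|\geq Cq^{d+\ell}$ for $1\leq i\leq\ell$, then there exists $S_1\subseteq S'\subseteq\prod_{i=1}^\ell A_i$ with $|S_1|\sim|S'|\sim\prod_{i=1}^\ell|A_i|$ such that $$\left|\Pi_{x_1,\ldots,x_\ell}(S(x_1,\ldots,x_\ell))\right|\gtrsim q^\ell$$ for every $(x_1,\ldots,x_\ell)\in S_1$.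
   Context: $\mathbb{F}_q$ is the finite field with $q$ elements and $x\cdot y=\sum_{i=1}^d x_iy_i$ for $x,y\in\mathbb{F}_q^d$. Notation: $X\lesssim Y$ means there is a constant $C'$ (independent of $q$ and of the sets involved) with $X\leq C'Y$; $X\gtrsim Y$ means $Y\lesssim X$; $X\sim Y$ means both $X\lesssim Y$ and $Y\lesssim X$. -}

module Defs where

open import Level using (0ℓ)
open import Data.Nat using (ℕ; suc; _*_; _^_; _+_)
open import Data.Fin using (Fin; inject₁; fromℕ)
open import Data.Fin.Properties using () renaming (_≟_ to _≟ᶠ_)
open import Data.Bool using (Bool; true; false; _∧_; T)
open import Data.List using (List; []; _∷_; length; filter; concatMap; map; allFin)
open import Data.Bool.ListAction using (any)
open import Data.Vec using (Vec; []; _∷_; _∷ʳ_; lookup; zipWith; foldr)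
import Data.Vec as V
open import Data.Vec.Properties using (≡-dec)
open import Data.Product using (Σ; _×_; _,_)
open import Relation.Binary.PropositionalEquality using (_≡_)
open import Relation.Nullary using (¬_; does)
open import Relation.Nullary.Decidable using (⌊_⌋)
open import Algebra.Structures using (IsCommutativeRing)

-- A finite field with q elements, realised on the carrier Fin q
-- (every finite field of order q is isomorphic to one of these).
record FiniteField (q : ℕ) : Set where
  field
    _+ᶠ_ _*ᶠ_ : Fin q → Fin q → Fin q
    -ᶠ_ : Fin q → Fin q
    0ᶠ 1ᶠ : Fin q
    isCommutativeRing : IsCommutativeRing _≡_ _+ᶠ_ _*ᶠ_ -ᶠ_ 0ᶠ 1ᶠ
    0≢1 : ¬ (0ᶠ ≡ 1ᶠ)
    inverse : (x : Fin q) → ¬ (x ≡ 0ᶠ) → Σ (Fin q) λ y → (x *ᶠ y) ≡ 1ᶠ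

allVec : {A : Set} → List A → (n : ℕ) → List (Vec A n)
allVec xs 0 = [] ∷ []
allVec xs (suc n) = concatMap (λ v → map (λ x → x ∷ v) xs) (allVec xs n)

Point : ℕ → ℕ → Set
Point q d = Vec (Fin q) d

points : (q d : ℕ) → List (Point q d)
points q d = allVec (allFin q) d

-- a (decidable) subset of a finite type is a Boolean-valued function
-- cardinality of a subset given by enumerating its ambient finite type
card : {X : Set} → List X → (X → Bool) → ℕ
card xs P = length (filter (λ x → Data.Bool._≟_ (P x) true) xs)

∣_∣ₚ : {q d : ℕ} → (Point q d → Bool) → ℕ
∣_∣ₚ {q} {d} A = card (points q d) A

tuples : (q d k : ℕ) → List (Vec (Point q d) k)
tuples q d k = allVec (points q d) k

∣_∣ₜ : {q d k : ℕ} → (Vec (Point q d) k → Bool) → ℕ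
∣_∣ₜ {q} {d} {k} S = card (tuples q d k) S

_⊆_ : {X : Set} → (X → Bool) → (X → Bool) → Set
P ⊆ Q = ∀ x → T (P x) → T (Q x)

∏ : (k : ℕ) → (Fin k → ℕ) → ℕ
∏ k f = Data.List.foldr _*_ 1 (map f (allFin k))

module _ {q : ℕ} (F : FiniteField q) where
  open FiniteField F

  dot : {d : ℕ} → Point q d → Point q d → Fin q
  dot x y = foldr _ _+ᶠ_ 0ᶠ (zipWith _*ᶠ_ x y)

  -- S' = {(x_1..x_ℓ) : ∃ x_{ℓ+1} ∈ A_{ℓ+1}, (x_1..x_{ℓ+1}) ∈ S}
  -- (S is assumed to lie in the product, so x_{ℓ+1} ∈ A_{ℓ+1} is automatic;
  --  we nevertheless test it explicitly)
  S′ : {d ℓ : ℕ} → (Fin (suc ℓ) → Point q d → Bool) →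
       (Vec (Point q d) (suc ℓ) → Bool) → Vec (Point q d) ℓ → Bool
  S′ {d} {ℓ} A S x = any (λ y → A (fromℕ ℓ) y ∧ S (x ∷ʳ y)) (points q d)

  Π : {d ℓ : ℕ} → (Fin (suc ℓ) → Point q d → Bool) →
      (Vec (Point q d) (suc ℓ) → Bool) → Vec (Point q d) ℓ → Point q ℓ → Bool
  Π {d} {ℓ} A S x z =
    any (λ y → A (fromℕ ℓ) y ∧ S (x ∷ʳ y) ∧ ⌊ ≡-dec _≟ᶠ_ z (V.map (λ xi → dot xi y) x) ⌋)
        (points q d)

-- Let B = A_{ℓ+1}, φ_x(y) = (x_1·y, …, x_ℓ·y) and E(x) = #{(y, y′) ∈ B² : φ_x(y) = φ_x(y′)}.
-- Cauchy–Schwarz over the fibres of φ_x gives |S(x)|² ≤ |Π_x(S(x))| E(x), so it suffices that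
-- E(x) ≲ |B|²/q^ℓ and |S(x)| ≳ |B| for most x ∈ ∏ A_i. The second holds by density of S
-- (pigeonhole), the first by Markov from q^ℓ Σ_{x ∈ ∏ A_i} E(x) ≤ (ℓ+1) ∏ |A_i| |B|². That bound
-- is proved one coordinate at a time: for y ≠ y′ the equation x_i·y = x_i·y′ holds for q^(d-1)
-- of the x_i ∈ F_q^d, so averaging over x_i divides the energy by q up to an error q^(d+1) |B|,
-- which the hypothesis |A_i| |B| ≥ q^(d+ℓ) absorbs when the average is taken over A_i only.

{-# OPTIONS --safe #-}
module Submission where

open import Defs
open import Data.Bool using (Bool; true; false; T; _∧_; not)
open import Data.Bool.Properties using (T-∧)
open import Data.Bool.ListAction using (any)
open import Data.Fin using (Fin; zero; suc; inject₁; fromℕ; fromℕ<)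
open import Data.Fin.Properties using (nonZeroIndex) renaming (_≟_ to _≟ᶠ_; suc-injective to fsuc-injective)
open import Data.List using (List; []; _∷_; _++_; map; concatMap; length; allFin; foldr)
open import Data.List.Properties using (map-tabulate; length-tabulate)
open import Data.Nat using (ℕ; zero; suc; _+_; _*_; _^_; _≤_; _<_; _≤?_; z≤n; s≤s; NonZero; >-nonZero; >-nonZero⁻¹)
open import Data.Nat.Properties
open import Data.Nat.Tactic.RingSolver using (solve-∀)
open import Data.Sum using ([_,_]′)
open import Data.Empty using (⊥-elim)
open import Data.Product using (Σ; _,_; _×_; proj₁; proj₂)
open import Data.Vec using (Vec; []; _∷_; _∷ʳ_; lookup)
import Data.Vec as Vec
open import Data.Vec.Properties using (≡-dec)
open import Function using (_∘_; id; _⇔_; mk⇔; Equivalence)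
open import Function.Properties.Equivalence using (⇔-setoid)
open import Level using (0ℓ)
open import Algebra.Bundles using (CommutativeRing)
open import Relation.Binary.Definitions using (DecidableEquality)
open import Relation.Binary.PropositionalEquality
open import Relation.Nullary using (yes; no; does; contradiction)
open import Relation.Nullary.Decidable using (dec-true; dec-false; ⌊_⌋)

variable
  X Y : Set

∑ : List X → (X → ℕ) → ℕ
∑ []       f = 0
∑ (x ∷ xs) f = f x + ∑ xs f

infix 5 ∑
syntax ∑ xs (λ x → e) = ∑[ x ∈ xs ] e

∑-cong : (xs : List X) {f g : X → ℕ} → (∀ x → f x ≡ g x) → ∑ xs f ≡ ∑ xs g
∑-cong []       f≡g = refl
∑-cong (x ∷ xs) f≡g = cong₂ _+_ (f≡g x) (∑-cong xs f≡g)

∑-mono-≤ : (xs : List X) {f g : X → ℕ} → (∀ x → f x ≤ g x) → ∑ xs f ≤ ∑ xs g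
∑-mono-≤ []       f≤g = z≤n
∑-mono-≤ (x ∷ xs) f≤g = +-mono-≤ (f≤g x) (∑-mono-≤ xs f≤g)

∑-distrib-+ : (xs : List X) (f g : X → ℕ) → (∑[ x ∈ xs ] f x + g x) ≡ ∑ xs f + ∑ xs g
∑-distrib-+ []       f g = refl
∑-distrib-+ (x ∷ xs) f g rewrite ∑-distrib-+ xs f g = +-+-interchange (f x) (g x) (∑ xs f) (∑ xs g)
  where
  +-+-interchange : ∀ a b c d → a + b + (c + d) ≡ a + c + (b + d)
  +-+-interchange = solve-∀

*-distribˡ-∑ : (c : ℕ) (xs : List X) (f : X → ℕ) → c * ∑ xs f ≡ (∑[ x ∈ xs ] c * f x)
*-distribˡ-∑ c []       f = *-zeroʳ c
*-distribˡ-∑ c (x ∷ xs) f = trans (*-distribˡ-+ c (f x) (∑ xs f)) (cong (c * f x +_) (*-distribˡ-∑ c xs f))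

*-distribʳ-∑ : (c : ℕ) (xs : List X) (f : X → ℕ) → ∑ xs f * c ≡ (∑[ x ∈ xs ] f x * c)
*-distribʳ-∑ c xs f = trans (*-comm (∑ xs f) c) (trans (*-distribˡ-∑ c xs f) (∑-cong xs λ x → *-comm c (f x)))

∑-const : (xs : List X) (c : ℕ) → (∑[ x ∈ xs ] c) ≡ length xs * c
∑-const []       c = refl
∑-const (x ∷ xs) c = cong (c +_) (∑-const xs c)

∑-zero : (xs : List X) {f : X → ℕ} → (∀ x → f x ≡ 0) → ∑ xs f ≡ 0
∑-zero xs f≡0 = trans (∑-cong xs f≡0) (trans (∑-const xs 0) (*-zeroʳ (length xs)))

∑-++ : (xs ys : List X) (f : X → ℕ) → ∑ (xs ++ ys) f ≡ ∑ xs f + ∑ ys f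
∑-++ []       ys f = refl
∑-++ (x ∷ xs) ys f = trans (cong (f x +_) (∑-++ xs ys f)) (sym (+-assoc (f x) _ _))

∑-comm : (xs : List X) (ys : List Y) (f : X → Y → ℕ) →
         (∑[ x ∈ xs ] ∑[ y ∈ ys ] f x y) ≡ (∑[ y ∈ ys ] ∑[ x ∈ xs ] f x y)
∑-comm []       ys f = sym (trans (∑-const ys 0) (*-zeroʳ (length ys)))
∑-comm (x ∷ xs) ys f = trans (cong (∑ ys (f x) +_) (∑-comm xs ys f))
                             (sym (∑-distrib-+ ys (f x) (λ y → ∑[ x ∈ xs ] f x y)))

∑*∑ : (xs : List X) (ys : List Y) (f : X → ℕ) (g : Y → ℕ) →
      ∑ xs f * ∑ ys g ≡ (∑[ x ∈ xs ] ∑[ y ∈ ys ] f x * g y)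
∑*∑ xs ys f g = trans (*-distribʳ-∑ (∑ ys g) xs f) (∑-cong xs λ x → *-distribˡ-∑ (f x) ys g)

∑-map : (h : X → Y) (xs : List X) (f : Y → ℕ) → ∑ (map h xs) f ≡ ∑ xs (f ∘ h)
∑-map h []       f = refl
∑-map h (x ∷ xs) f = cong (f (h x) +_) (∑-map h xs f)

∑-concatMap : (g : X → List Y) (xs : List X) (f : Y → ℕ) →
              ∑ (concatMap g xs) f ≡ (∑[ x ∈ xs ] ∑ (g x) f)
∑-concatMap g []       f = refl
∑-concatMap g (x ∷ xs) f = trans (∑-++ (g x) (concatMap g xs) f) (cong (∑ (g x) f +_) (∑-concatMap g xs f))

𝟙 : Bool → ℕ
𝟙 true  = 1
𝟙 false = 0

𝟙-∧ : ∀ a b → 𝟙 (a ∧ b) ≡ 𝟙 a * 𝟙 b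
𝟙-∧ true  b = sym (+-identityʳ (𝟙 b))
𝟙-∧ false b = refl

𝟙-idem : ∀ b → 𝟙 b * 𝟙 b ≡ 𝟙 b
𝟙-idem true  = refl
𝟙-idem false = refl

𝟙+𝟙-not : ∀ b → 𝟙 b + 𝟙 (not b) ≡ 1
𝟙+𝟙-not true  = refl
𝟙+𝟙-not false = refl

𝟙-mono : ∀ {a b} → (T a → T b) → 𝟙 a ≤ 𝟙 b
𝟙-mono {false}         a⇒b = z≤n
𝟙-mono {true} {true}  a⇒b = ≤-refl
𝟙-mono {true} {false} a⇒b = contradiction (a⇒b _) λ ()

𝟙-∧-absorbˡ : ∀ {b s} → (T s → T b) → 𝟙 (b ∧ s) ≡ 𝟙 s
𝟙-∧-absorbˡ {true}          _   = refl
𝟙-∧-absorbˡ {false} {false} _   = refl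
𝟙-∧-absorbˡ {false} {true}  s⇒b = ⊥-elim (s⇒b _)

𝟙-∧-≤-split : ∀ a p o → 𝟙 (a ∧ p) ≤ 𝟙 (a ∧ p ∧ o) + 𝟙 (a ∧ not o)
𝟙-∧-≤-split false p     o     = z≤n
𝟙-∧-≤-split true  false o     = z≤n
𝟙-∧-≤-split true  true  true  = s≤s z≤n
𝟙-∧-≤-split true  true  false = s≤s z≤n

card≡∑𝟙 : (xs : List X) (P : X → Bool) → card xs P ≡ ∑ xs (𝟙 ∘ P)
card≡∑𝟙 []       P = refl
card≡∑𝟙 (x ∷ xs) P with P x
... | true  = cong suc (card≡∑𝟙 xs P)
... | false = card≡∑𝟙 xs P

card-mono : (xs : List X) {P Q : X → Bool} → P ⊆ Q → card xs P ≤ card xs Q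
card-mono xs {P} {Q} P⊆Q = subst₂ _≤_ (sym (card≡∑𝟙 xs P)) (sym (card≡∑𝟙 xs Q)) (∑-mono-≤ xs (λ x → 𝟙-mono (P⊆Q x)))

any-false⇒∑≡0 : (xs : List X) (p : X → Bool) (f : X → ℕ) → (∀ x → p x ≡ false → f x ≡ 0) →
                any p xs ≡ false → ∑ xs f ≡ 0
any-false⇒∑≡0 []       p f _    _ = refl
any-false⇒∑≡0 (x ∷ xs) p f f≡0 none with p x in px
... | false = cong₂ _+_ (f≡0 x px) (any-false⇒∑≡0 xs p f f≡0 none)

∑𝟙>0⇒any : (xs : List X) (p : X → Bool) → 0 < ∑ xs (𝟙 ∘ p) → T (any p xs)
∑𝟙>0⇒any (x ∷ xs) p pos with p x
... | true  = _
... | false = ∑𝟙>0⇒any xs p pos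

2*m*n≤m²+n² : ∀ m n → 2 * (m * n) ≤ m * m + n * n
2*m*n≤m²+n² m n = [ ordered , flipped ]′ (≤-total m n)
  where
  ordered : ∀ {m n} → m ≤ n → 2 * (m * n) ≤ m * m + n * n
  ordered {m} m≤n with k , refl ← m≤n⇒∃[o]m+o≡n m≤n = subst (2 * (m * (m + k)) ≤_) (gap m k) (m≤m+n _ (k * k))
    where
    gap : ∀ m k → 2 * (m * (m + k)) + k * k ≡ m * m + (m + k) * (m + k)
    gap = solve-∀
  flipped : n ≤ m → 2 * (m * n) ≤ m * m + n * n
  flipped n≤m = subst₂ _≤_ (cong (2 *_) (*-comm n m)) (+-comm (n * n) (m * m)) (ordered n≤m)

-- Averaging 2 f(x) f(y) ≤ f(x)² + f(y)² over pairs in the support of g.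
cauchy-schwarz : (xs : List X) (g : X → Bool) (f : X → ℕ) → (∀ x → g x ≡ false → f x ≡ 0) →
                 ∑ xs f * ∑ xs f ≤ ∑ xs (𝟙 ∘ g) * (∑[ x ∈ xs ] f x * f x)
cauchy-schwarz xs g f supp = *-cancelˡ-≤ 2 (begin
  2 * (∑ xs f * ∑ xs f)
    ≡⟨ cong (2 *_) (∑*∑ xs xs f f) ⟩
  2 * (∑[ x ∈ xs ] ∑[ y ∈ xs ] f x * f y)
    ≡⟨ *-distribˡ-∑ 2 xs _ ⟩
  (∑[ x ∈ xs ] 2 * (∑[ y ∈ xs ] f x * f y))
    ≡⟨ ∑-cong xs (λ x → *-distribˡ-∑ 2 xs _) ⟩
  (∑[ x ∈ xs ] ∑[ y ∈ xs ] 2 * (f x * f y))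
    ≤⟨ ∑-mono-≤ xs (λ x → ∑-mono-≤ xs (pair x)) ⟩
  (∑[ x ∈ xs ] ∑[ y ∈ xs ] f x * f x * 𝟙 (g y) + 𝟙 (g x) * (f y * f y))
    ≡⟨ ∑-cong xs (λ x → ∑-distrib-+ xs _ _) ⟩
  (∑[ x ∈ xs ] (∑[ y ∈ xs ] f x * f x * 𝟙 (g y)) + (∑[ y ∈ xs ] 𝟙 (g x) * (f y * f y)))
    ≡⟨ ∑-distrib-+ xs _ _ ⟩
  (∑[ x ∈ xs ] ∑[ y ∈ xs ] f x * f x * 𝟙 (g y)) + (∑[ x ∈ xs ] ∑[ y ∈ xs ] 𝟙 (g x) * (f y * f y))
    ≡⟨ sym (cong₂ _+_ (∑*∑ xs xs _ (𝟙 ∘ g)) (∑*∑ xs xs (𝟙 ∘ g) _)) ⟩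
  Q * m + m * Q
    ≡⟨ double Q m ⟩
  2 * (m * Q) ∎)
  where
  open ≤-Reasoning
  m Q : ℕ
  m = ∑ xs (𝟙 ∘ g)
  Q = ∑[ x ∈ xs ] f x * f x
  double : ∀ a b → a * b + b * a ≡ 2 * (b * a)
  double = solve-∀
  pair : ∀ x y → 2 * (f x * f y) ≤ f x * f x * 𝟙 (g y) + 𝟙 (g x) * (f y * f y)
  pair x y with g x in gx | g y in gy
  ... | true  | true  = ≤-trans (2*m*n≤m²+n² (f x) (f y))
                          (≤-reflexive (sym (cong₂ _+_ (*-identityʳ (f x * f x)) (*-identityˡ (f y * f y)))))
  ... | false | _     rewrite supp x gx = z≤n
  ... | true  | false rewrite supp y gy | *-zeroʳ (f x) = z≤n

∑-𝟙+∑-𝟙-not : (xs : List X) (A : X → Bool) (f : X → ℕ) →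
                (∑[ x ∈ xs ] 𝟙 (A x) * f x) + (∑[ x ∈ xs ] 𝟙 (not (A x)) * f x) ≡ ∑ xs f
∑-𝟙+∑-𝟙-not xs A f = trans (sym (∑-distrib-+ xs _ _)) (∑-cong xs λ x →
  trans (sym (*-distribʳ-+ (f x) (𝟙 (A x)) _)) (trans (cong (_* f x) (𝟙+𝟙-not (A x))) (*-identityˡ (f x))))

-- If no term is below E, the terms outside A contribute at least E each to the sum.
∑-restrict-≤ : (xs : List X) (A : X → Bool) (f : X → ℕ) {E R : ℕ} → (∀ x → E ≤ f x) →
               ∑ xs f ≤ length xs * E + R → (∑[ x ∈ xs ] 𝟙 (A x) * f x) ≤ ∑ xs (𝟙 ∘ A) * E + R
∑-restrict-≤ xs A f {E} {R} E≤f ∑f≤ = +-cancelʳ-≤ (nA * E) inA (∑ xs (𝟙 ∘ A) * E + R) (begin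
  inA + nA * E                                  ≤⟨ +-monoʳ-≤ inA outside ⟩
  inA + (∑[ x ∈ xs ] 𝟙 (not (A x)) * f x)       ≡⟨ ∑-𝟙+∑-𝟙-not xs A f ⟩
  ∑ xs f                                        ≤⟨ ∑f≤ ⟩
  length xs * E + R                             ≡⟨ cong (λ l → l * E + R) length≡ ⟩
  (∑ xs (𝟙 ∘ A) + nA) * E + R                   ≡⟨ rearrange (∑ xs (𝟙 ∘ A)) nA E R ⟩
  ∑ xs (𝟙 ∘ A) * E + R + nA * E                 ∎)
  where
  open ≤-Reasoning
  inA nA : ℕ
  inA = ∑[ x ∈ xs ] 𝟙 (A x) * f x
  nA  = ∑[ x ∈ xs ] 𝟙 (not (A x))
  outside : nA * E ≤ (∑[ x ∈ xs ] 𝟙 (not (A x)) * f x)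
  outside = ≤-trans (≤-reflexive (*-distribʳ-∑ E xs _)) (∑-mono-≤ xs λ x → *-monoʳ-≤ (𝟙 (not (A x))) (E≤f x))
  length≡ : length xs ≡ ∑ xs (𝟙 ∘ A) + nA
  length≡ = trans (sym (trans (∑-const xs 1) (*-identityʳ _)))
                  (trans (sym (∑-𝟙+∑-𝟙-not xs A (λ _ → 1)))
                         (cong₂ _+_ (∑-cong xs λ x → *-identityʳ (𝟙 (A x)))
                                    (∑-cong xs λ x → *-identityʳ (𝟙 (not (A x))))))
  rearrange : ∀ a n e r → (a + n) * e + r ≡ a * e + r + n * e
  rearrange = solve-∀

-- The x with t x < b/2k carry at most |A| b/2k, half of the lower bound |A| b/k on ∑ t,
-- and every other x carries at most b.
popular-≥ : (xs : List X) (a : X → Bool) (t : X → ℕ) (b k : ℕ) .{{_ : NonZero b}} →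
            (∀ x → t x ≤ 𝟙 (a x) * b) → ∑ xs (𝟙 ∘ a) * b ≤ k * ∑ xs t →
            ∑ xs (𝟙 ∘ a) ≤ 2 * k * (∑[ x ∈ xs ] 𝟙 (a x ∧ ⌊ b ≤? 2 * k * t x ⌋))
popular-≥ {X} xs a t b k t≤b dense = *-cancelʳ-≤ P (2 * k * G) b (+-cancelʳ-≤ (P * b) (P * b) (2 * k * G * b) (begin
  P * b + P * b
    ≡⟨ double (P * b) ⟩
  2 * (P * b)
    ≤⟨ *-monoʳ-≤ 2 dense ⟩
  2 * (k * ∑ xs t)
    ≡⟨ trans (sym (*-assoc 2 k (∑ xs t))) (*-distribˡ-∑ (2 * k) xs t) ⟩
  (∑[ x ∈ xs ] 2 * k * t x)
    ≤⟨ ∑-mono-≤ xs pointwise ⟩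
  (∑[ x ∈ xs ] 2 * k * b * 𝟙 (popular x) + 𝟙 (a x) * b)
    ≡⟨ ∑-distrib-+ xs _ _ ⟩
  (∑[ x ∈ xs ] 2 * k * b * 𝟙 (popular x)) + (∑[ x ∈ xs ] 𝟙 (a x) * b)
    ≡⟨ cong₂ _+_ (trans (sym (rearrange (2 * k) b G)) (*-distribˡ-∑ (2 * k * b) xs _)) (*-distribʳ-∑ b xs (𝟙 ∘ a)) ⟨
  2 * k * G * b + P * b ∎))
  where
  open ≤-Reasoning
  P G : ℕ
  P = ∑ xs (𝟙 ∘ a)
  popular : X → Bool
  popular x = a x ∧ ⌊ b ≤? 2 * k * t x ⌋
  G = ∑ xs (𝟙 ∘ popular)
  double : ∀ n → n + n ≡ 2 * n
  double = solve-∀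
  rearrange : ∀ k b g → k * b * g ≡ k * g * b
  rearrange = solve-∀
  pointwise : ∀ x → 2 * k * t x ≤ 2 * k * b * 𝟙 (popular x) + 𝟙 (a x) * b
  pointwise x with a x | t≤b x
  ... | false | t≤0 rewrite n≤0⇒n≡0 t≤0 | *-zeroʳ (2 * k) = z≤n
  ... | true  | t≤b′ with b ≤? 2 * k * t x
  ...   | yes _   = ≤-trans (*-monoʳ-≤ (2 * k) (≤-trans t≤b′ (≤-reflexive (+-identityʳ b))))
                            (≤-trans (≤-reflexive (sym (*-identityʳ (2 * k * b)))) (m≤m+n _ _))
  ...   | no b≰2kt = ≤-trans (<⇒≤ (≰⇒> b≰2kt))
                             (≤-trans (≤-reflexive (sym (+-identityʳ b))) (m≤n+m (b + 0) (2 * k * b * 0)))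

markov : (xs : List X) (a : X → Bool) (f : X → ℕ) (v : ℕ) →
         v * (∑[ x ∈ xs ] 𝟙 (a x ∧ not ⌊ f x ≤? v ⌋)) ≤ (∑[ x ∈ xs ] 𝟙 (a x) * f x)
markov xs a f v = ≤-trans (≤-reflexive (*-distribˡ-∑ v xs _)) (∑-mono-≤ xs pointwise)
  where
  pointwise : ∀ x → v * 𝟙 (a x ∧ not ⌊ f x ≤? v ⌋) ≤ 𝟙 (a x) * f x
  pointwise x with a x
  ... | false rewrite *-zeroʳ v = z≤n
  ... | true with f x ≤? v
  ...   | yes _   rewrite *-zeroʳ v = z≤n
  ...   | no f≰v  = subst₂ _≤_ (sym (*-identityʳ v)) (sym (+-identityʳ (f x))) (<⇒≤ (≰⇒> f≰v))

∑-allFin-suc : ∀ n (f : Fin (suc n) → ℕ) → ∑ (allFin (suc n)) f ≡ f zero + ∑ (allFin n) (f ∘ suc)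
∑-allFin-suc n f =
  cong (f zero +_) (trans (cong (λ is → ∑ is f) (sym (map-tabulate id suc))) (∑-map suc (allFin n) f))

∑-allFin-const : ∀ n c → (∑[ i ∈ allFin n ] c) ≡ n * c
∑-allFin-const n c = trans (∑-const (allFin n) c) (cong (_* c) (length-tabulate {n = n} id))

∑-allVec-suc : (xs : List X) (n : ℕ) (f : Vec X (suc n) → ℕ) →
               ∑ (allVec xs (suc n)) f ≡ (∑[ v ∈ allVec xs n ] ∑[ x ∈ xs ] f (x ∷ v))
∑-allVec-suc xs n f = trans (∑-concatMap _ (allVec xs n) f) (∑-cong (allVec xs n) λ v → ∑-map (_∷ v) xs f)

∑-allVec-snoc : (xs : List X) (n : ℕ) (f : Vec X (suc n) → ℕ) →
                ∑ (allVec xs (suc n)) f ≡ (∑[ v ∈ allVec xs n ] ∑[ y ∈ xs ] f (v ∷ʳ y))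
∑-allVec-snoc xs zero    f = ∑-allVec-suc xs zero f
∑-allVec-snoc xs (suc n) f = begin
  ∑ (allVec xs (suc (suc n))) f
    ≡⟨ ∑-allVec-suc xs (suc n) f ⟩
  (∑[ v ∈ allVec xs (suc n) ] ∑[ x ∈ xs ] f (x ∷ v))
    ≡⟨ ∑-allVec-snoc xs n _ ⟩
  (∑[ w ∈ allVec xs n ] ∑[ y ∈ xs ] ∑[ x ∈ xs ] f (x ∷ (w ∷ʳ y)))
    ≡⟨ ∑-cong (allVec xs n) (λ w → ∑-comm xs xs _) ⟩
  (∑[ w ∈ allVec xs n ] ∑[ x ∈ xs ] ∑[ y ∈ xs ] f ((x ∷ w) ∷ʳ y))
    ≡⟨ ∑-allVec-suc xs n _ ⟨
  (∑[ v ∈ allVec xs (suc n) ] ∑[ y ∈ xs ] f (v ∷ʳ y)) ∎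
  where open ≡-Reasoning

length-allVec : (xs : List X) (n : ℕ) → length (allVec xs n) ≡ length xs ^ n
length-allVec xs zero    = refl
length-allVec xs (suc n) = begin
  length (allVec xs (suc n))                   ≡⟨ length≡∑1 (allVec xs (suc n)) ⟩
  (∑[ v ∈ allVec xs (suc n) ] 1)               ≡⟨ ∑-allVec-suc xs n _ ⟩
  (∑[ v ∈ allVec xs n ] ∑[ x ∈ xs ] 1)         ≡⟨ ∑-cong (allVec xs n) (λ _ → length≡∑1 xs) ⟨
  (∑[ v ∈ allVec xs n ] length xs)             ≡⟨ ∑-const (allVec xs n) (length xs) ⟩
  length (allVec xs n) * length xs             ≡⟨ cong (_* length xs) (length-allVec xs n) ⟩
  length xs ^ n * length xs                    ≡⟨ *-comm (length xs ^ n) (length xs) ⟩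
  length xs ^ suc n                            ∎
  where
  open ≡-Reasoning
  length≡∑1 : (ys : List Y) → length ys ≡ (∑[ y ∈ ys ] 1)
  length≡∑1 ys = sym (trans (∑-const ys 1) (*-identityʳ (length ys)))

length-points : ∀ q d → length (points q d) ≡ q ^ d
length-points q d = trans (length-allVec (allFin q) d) (cong (_^ d) (length-tabulate id))

∑-points-const : ∀ q d c → (∑[ x ∈ points q d ] c) ≡ q ^ d * c
∑-points-const q d c = trans (∑-const (points q d) c) (cong (_* c) (length-points q d))

∏-suc : ∀ n (f : Fin (suc n) → ℕ) → ∏ (suc n) f ≡ f zero * ∏ n (f ∘ suc)
∏-suc n f = cong (λ fs → f zero * foldr _*_ 1 fs) (trans (map-tabulate suc f) (sym (map-tabulate id (f ∘ suc))))

∏-snoc : ∀ n (f : Fin (suc n) → ℕ) → ∏ (suc n) f ≡ ∏ n (f ∘ inject₁) * f (fromℕ n)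
∏-snoc zero    f = *-comm (f zero) 1
∏-snoc (suc n) f = begin
  ∏ (suc (suc n)) f                                          ≡⟨ ∏-suc (suc n) f ⟩
  f zero * ∏ (suc n) (f ∘ suc)                               ≡⟨ cong (f zero *_) (∏-snoc n (f ∘ suc)) ⟩
  f zero * (∏ n (f ∘ suc ∘ inject₁) * f (fromℕ (suc n)))    ≡⟨ *-assoc (f zero) _ _ ⟨
  f zero * ∏ n (f ∘ suc ∘ inject₁) * f (fromℕ (suc n))      ≡⟨ cong (_* f (fromℕ (suc n))) (∏-suc n (f ∘ inject₁)) ⟨
  ∏ (suc n) (f ∘ inject₁) * f (fromℕ (suc n))               ∎
  where open ≡-Reasoning

lookup-∷ʳ-fromℕ : ∀ {n} (x : Vec X n) (y : X) → lookup (x ∷ʳ y) (fromℕ n) ≡ y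
lookup-∷ʳ-fromℕ []      y = refl
lookup-∷ʳ-fromℕ (_ ∷ x) y = lookup-∷ʳ-fromℕ x y

lookup-∷ʳ-inject₁ : ∀ {n} (x : Vec X n) (y : X) (i : Fin n) → lookup (x ∷ʳ y) (inject₁ i) ≡ lookup x i
lookup-∷ʳ-inject₁ (_ ∷ x) y zero    = refl
lookup-∷ʳ-inject₁ (_ ∷ x) y (suc i) = lookup-∷ʳ-inject₁ x y i

box : {n : ℕ} → (Fin n → X → Bool) → Vec X n → Bool
box A []       = true
box A (x ∷ xs) = A zero x ∧ box (A ∘ suc) xs

∑-box : (xs : List X) (n : ℕ) (A : Fin n → X → Bool) →
        (∑[ v ∈ allVec xs n ] 𝟙 (box A v)) ≡ ∏ n (λ i → card xs (A i))
∑-box xs zero    A = refl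
∑-box xs (suc n) A = begin
  (∑[ v ∈ allVec xs (suc n) ] 𝟙 (box A v))
    ≡⟨ ∑-allVec-suc xs n _ ⟩
  (∑[ v ∈ allVec xs n ] ∑[ x ∈ xs ] 𝟙 (A zero x ∧ box (A ∘ suc) v))
    ≡⟨ ∑-cong (allVec xs n) (λ v → ∑-cong xs λ x → 𝟙-∧ (A zero x) _) ⟩
  (∑[ v ∈ allVec xs n ] ∑[ x ∈ xs ] 𝟙 (A zero x) * 𝟙 (box (A ∘ suc) v))
    ≡⟨ ∑-cong (allVec xs n) (λ v → *-distribʳ-∑ _ xs _) ⟨
  (∑[ v ∈ allVec xs n ] ∑ xs (𝟙 ∘ A zero) * 𝟙 (box (A ∘ suc) v))
    ≡⟨ *-distribˡ-∑ (∑ xs (𝟙 ∘ A zero)) (allVec xs n) (𝟙 ∘ box (A ∘ suc)) ⟨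
  ∑ xs (𝟙 ∘ A zero) * (∑[ v ∈ allVec xs n ] 𝟙 (box (A ∘ suc) v))
    ≡⟨ cong₂ _*_ (card≡∑𝟙 xs (A zero)) (sym (∑-box xs n (A ∘ suc))) ⟨
  card xs (A zero) * ∏ n (λ i → card xs (A (suc i)))
    ≡⟨ ∏-suc n (λ i → card xs (A i)) ⟨
  ∏ (suc n) (λ i → card xs (A i)) ∎
  where open ≡-Reasoning

box-intro : ∀ {n} (A : Fin n → X → Bool) (x : Vec X n) → (∀ i → T (A i (lookup x i))) → T (box A x)
box-intro A []      _    = _
box-intro A (_ ∷ x) x∈A = Equivalence.from T-∧ (x∈A zero , box-intro (A ∘ suc) x (x∈A ∘ suc))

module KroneckerDelta (_≟_ : DecidableEquality X) where

  δ : X → X → ℕ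
  δ a b = 𝟙 (does (a ≟ b))

  δ-refl : ∀ a → δ a a ≡ 1
  δ-refl a = cong 𝟙 (dec-true (a ≟ a) refl)

  δ-≢ : {a b : X} → a ≢ b → δ a b ≡ 0
  δ-≢ {a} {b} a≢b = cong 𝟙 (dec-false (a ≟ b) a≢b)

  δ-sym : ∀ a b → δ a b ≡ δ b a
  δ-sym a b with a ≟ b
  ... | yes refl = sym (δ-refl a)
  ... | no a≢b   = sym (δ-≢ (a≢b ∘ sym))

  δ-subst : ∀ a b (f : X → ℕ) → δ a b * f a ≡ δ a b * f b
  δ-subst a b f with a ≟ b
  ... | yes refl = refl
  ... | no _     = refl

  Enumerates : List X → Set
  Enumerates xs = ∀ a → (∑[ z ∈ xs ] δ z a) ≡ 1

  ∑-δ : {xs : List X} → Enumerates xs → ∀ a (f : X → ℕ) → (∑[ z ∈ xs ] δ z a * f z) ≡ f a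
  ∑-δ {xs} enum a f = begin
    (∑[ z ∈ xs ] δ z a * f z)   ≡⟨ ∑-cong xs (λ z → δ-subst z a f) ⟩
    (∑[ z ∈ xs ] δ z a * f a)   ≡⟨ *-distribʳ-∑ (f a) xs _ ⟨
    (∑[ z ∈ xs ] δ z a) * f a   ≡⟨ cong (_* f a) (enum a) ⟩
    1 * f a                     ≡⟨ *-identityˡ (f a) ⟩
    f a                         ∎
    where open ≡-Reasoning

open KroneckerDelta

δ-cong : (_≟₁_ : DecidableEquality X) (_≟₂_ : DecidableEquality Y) {a b : X} {c e : Y} →
         (a ≡ b ⇔ c ≡ e) → δ _≟₁_ a b ≡ δ _≟₂_ c e
δ-cong _≟₁_ _≟₂_ {a} {b} {c} {e} a≡b⇔c≡e with a ≟₁ b | c ≟₂ e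
... | yes _    | yes _    = refl
... | no _     | no _     = refl
... | yes a≡b  | no c≢e   = contradiction (Equivalence.to a≡b⇔c≡e a≡b) c≢e
... | no a≢b   | yes c≡e  = contradiction (Equivalence.from a≡b⇔c≡e c≡e) a≢b

δ-∷ : (_≟_ : DecidableEquality X) {n : ℕ} (c a : X) (v w : Vec X n) →
      δ (≡-dec _≟_) (c ∷ v) (a ∷ w) ≡ δ _≟_ c a * δ (≡-dec _≟_) v w
δ-∷ _≟_ c a v w = 𝟙-∧ (does (c ≟ a)) _

allFin-enumerates : ∀ n → Enumerates _≟ᶠ_ (allFin n)
allFin-enumerates (suc n) zero    = begin
  (∑[ z ∈ allFin (suc n) ] δ _≟ᶠ_ z zero)
    ≡⟨ ∑-allFin-suc n (λ z → δ _≟ᶠ_ z zero) ⟩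
  1 + (∑[ z ∈ allFin n ] δ _≟ᶠ_ (suc z) zero)
    ≡⟨ cong (1 +_) (∑-zero (allFin n) (λ z → δ-≢ _≟ᶠ_ {suc z} {zero} λ ())) ⟩
  1 ∎
  where open ≡-Reasoning
allFin-enumerates (suc n) (suc a) = begin
  (∑[ z ∈ allFin (suc n) ] δ _≟ᶠ_ z (suc a))
    ≡⟨ ∑-allFin-suc n (λ z → δ _≟ᶠ_ z (suc a)) ⟩
  (∑[ z ∈ allFin n ] δ _≟ᶠ_ (suc z) (suc a))
    ≡⟨ ∑-cong (allFin n) (λ z → δ-cong _≟ᶠ_ _≟ᶠ_ {suc z} {suc a} {z} {a} (mk⇔ fsuc-injective (cong suc))) ⟩
  (∑[ z ∈ allFin n ] δ _≟ᶠ_ z a)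
    ≡⟨ allFin-enumerates n a ⟩
  1                                             ∎
  where open ≡-Reasoning

allVec-enumerates : (_≟_ : DecidableEquality X) {xs : List X} → Enumerates _≟_ xs →
                    ∀ n → Enumerates (≡-dec _≟_) (allVec xs n)
allVec-enumerates _≟_ enum zero    []      = refl
allVec-enumerates _≟_ {xs} enum (suc n) (a ∷ w) = begin
  (∑[ z ∈ allVec xs (suc n) ] δ (≡-dec _≟_) z (a ∷ w))
    ≡⟨ ∑-allVec-suc xs n _ ⟩
  (∑[ v ∈ allVec xs n ] ∑[ c ∈ xs ] δ (≡-dec _≟_) (c ∷ v) (a ∷ w))
    ≡⟨ ∑-cong (allVec xs n) (λ v → ∑-cong xs λ c → δ-∷ _≟_ c a v w) ⟩
  (∑[ v ∈ allVec xs n ] ∑[ c ∈ xs ] δ _≟_ c a * δ (≡-dec _≟_) v w)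
    ≡⟨ ∑-cong (allVec xs n) (λ v → *-distribʳ-∑ _ xs _) ⟨
  (∑[ v ∈ allVec xs n ] (∑[ c ∈ xs ] δ _≟_ c a) * δ (≡-dec _≟_) v w)
    ≡⟨ ∑-cong (allVec xs n) (λ v → cong (_* _) (enum a)) ⟩
  (∑[ v ∈ allVec xs n ] 1 * δ (≡-dec _≟_) v w)
    ≡⟨ ∑-cong (allVec xs n) (λ v → *-identityˡ _) ⟩
  (∑[ v ∈ allVec xs n ] δ (≡-dec _≟_) v w)
    ≡⟨ allVec-enumerates _≟_ enum n w ⟩
  1                                                                     ∎
  where open ≡-Reasoning

δᶠ : {q : ℕ} → Fin q → Fin q → ℕ
δᶠ = δ _≟ᶠ_

δᵛ : {q n : ℕ} → Point q n → Point q n → ℕ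
δᵛ = δ (≡-dec _≟ᶠ_)

∑-δᶠ : ∀ {q} (a : Fin q) (f : Fin q → ℕ) → (∑[ c ∈ allFin q ] δᶠ c a * f c) ≡ f a
∑-δᶠ {q} = ∑-δ _≟ᶠ_ {allFin q} (allFin-enumerates q)

points-enumerates : ∀ q d → Enumerates (≡-dec _≟ᶠ_) (points q d)
points-enumerates q = allVec-enumerates _≟ᶠ_ (allFin-enumerates q)

∑-δᵛ : ∀ {q m} (a : Point q m) (f : Point q m → ℕ) → (∑[ z ∈ points q m ] δᵛ z a * f z) ≡ f a
∑-δᵛ {q} {m} = ∑-δ (≡-dec _≟ᶠ_) {points q m} (points-enumerates q m)

-- Affine equations and dot products over F_q

module _ {q : ℕ} (F : FiniteField q) where

  open FiniteField F renaming (_+ᶠ_ to infixl 6 _+ᶠ_; _*ᶠ_ to infixl 7 _*ᶠ_; -ᶠ_ to infix 8 -ᶠ_)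

  private
    field-ring : CommutativeRing 0ℓ 0ℓ
    field-ring = record { isCommutativeRing = isCommutativeRing }
    module R = CommutativeRing field-ring

  open import Algebra.Properties.Ring R.ring using (x[y-z]≈xy-xz)
  open import Algebra.Properties.Group R.+-group using (x∙y⁻¹≈ε⇒x≈y; x≈y⇒x∙y⁻¹≈ε; inverseˡ-unique; ∙-cancelˡ)
  open import Algebra.Properties.AbelianGroup R.+-abelianGroup using (⁻¹-∙-comm)
  open import Algebra.Properties.CommutativeSemigroup R.+-commutativeSemigroup using (interchange)

  infixl 6 _-ᶠ_
  _-ᶠ_ : Fin q → Fin q → Fin q
  x -ᶠ y = x +ᶠ -ᶠ y

  x-y≡0⇔x≡y : ∀ x y → x -ᶠ y ≡ 0ᶠ ⇔ x ≡ y
  x-y≡0⇔x≡y x y = mk⇔ (x∙y⁻¹≈ε⇒x≈y x y) x≈y⇒x∙y⁻¹≈ε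

  x+y≡0⇔x≡-y : ∀ x y → x +ᶠ y ≡ 0ᶠ ⇔ x ≡ -ᶠ y
  x+y≡0⇔x≡-y x y = mk⇔ (inverseˡ-unique x y) (λ { refl → R.-‿inverseˡ y })

  *-unit-⇔ : ∀ {c i} → c *ᶠ i ≡ 1ᶠ → ∀ b r → b *ᶠ c ≡ r ⇔ b ≡ r *ᶠ i
  *-unit-⇔ {c} {i} c*i≡1 b r = mk⇔ divide (λ { refl → r*i*c≡r })
    where
    open ≡-Reasoning
    divide : b *ᶠ c ≡ r → b ≡ r *ᶠ i
    divide b*c≡r = begin
      b                ≡⟨ R.*-identityʳ b ⟨
      b *ᶠ 1ᶠ          ≡⟨ cong (b *ᶠ_) c*i≡1 ⟨
      b *ᶠ (c *ᶠ i)    ≡⟨ R.*-assoc b c i ⟨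
      b *ᶠ c *ᶠ i      ≡⟨ cong (_*ᶠ i) b*c≡r ⟩
      r *ᶠ i           ∎
    r*i*c≡r : r *ᶠ i *ᶠ c ≡ r
    r*i*c≡r = begin
      r *ᶠ i *ᶠ c      ≡⟨ R.*-assoc r i c ⟩
      r *ᶠ (i *ᶠ c)    ≡⟨ cong (r *ᶠ_) (trans (R.*-comm i c) c*i≡1) ⟩
      r *ᶠ 1ᶠ          ≡⟨ R.*-identityʳ r ⟩
      r                ∎

  affine-difference : ∀ b a a′ u u′ →
    (b *ᶠ a +ᶠ u) -ᶠ (b *ᶠ a′ +ᶠ u′) ≡ b *ᶠ (a -ᶠ a′) +ᶠ (u -ᶠ u′)
  affine-difference b a a′ u u′ = begin
    (b *ᶠ a +ᶠ u) -ᶠ (b *ᶠ a′ +ᶠ u′)                 ≡⟨ cong ((b *ᶠ a +ᶠ u) +ᶠ_) (⁻¹-∙-comm _ _) ⟨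
    (b *ᶠ a +ᶠ u) +ᶠ (-ᶠ (b *ᶠ a′) +ᶠ -ᶠ u′)         ≡⟨ interchange _ _ _ _ ⟩
    (b *ᶠ a -ᶠ b *ᶠ a′) +ᶠ (u -ᶠ u′)                 ≡⟨ cong (_+ᶠ (u -ᶠ u′)) (x[y-z]≈xy-xz b a a′) ⟨
    b *ᶠ (a -ᶠ a′) +ᶠ (u -ᶠ u′)                      ∎
    where open ≡-Reasoning

  affine-root : ∀ {a a′} → a ≢ a′ → ∀ u u′ → Fin q
  affine-root {a} {a′} a≢a′ u u′ = -ᶠ (u -ᶠ u′) *ᶠ proj₁ (inverse (a -ᶠ a′) (a≢a′ ∘ x∙y⁻¹≈ε⇒x≈y a a′))

  affine-root-unique : ∀ {a a′} (a≢a′ : a ≢ a′) u u′ b →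
    b *ᶠ a +ᶠ u ≡ b *ᶠ a′ +ᶠ u′ ⇔ b ≡ affine-root a≢a′ u u′
  affine-root-unique {a} {a′} a≢a′ u u′ b = begin
    b *ᶠ a +ᶠ u ≡ b *ᶠ a′ +ᶠ u′                   ≈⟨ x-y≡0⇔x≡y _ _ ⟨
    (b *ᶠ a +ᶠ u) -ᶠ (b *ᶠ a′ +ᶠ u′) ≡ 0ᶠ          ≡⟨ cong (_≡ 0ᶠ) (affine-difference b a a′ u u′) ⟩
    b *ᶠ (a -ᶠ a′) +ᶠ (u -ᶠ u′) ≡ 0ᶠ               ≈⟨ x+y≡0⇔x≡-y _ _ ⟩
    b *ᶠ (a -ᶠ a′) ≡ -ᶠ (u -ᶠ u′)                  ≈⟨ *-unit-⇔ (proj₂ (inverse _ _)) b _ ⟩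
    b ≡ affine-root a≢a′ u u′                       ∎
    where open import Relation.Binary.Reasoning.Setoid (⇔-setoid 0ℓ)

  ∑-δ-affine-≢ : ∀ {a a′} → a ≢ a′ → ∀ u u′ → (∑[ b ∈ allFin q ] δᶠ (b *ᶠ a +ᶠ u) (b *ᶠ a′ +ᶠ u′)) ≡ 1
  ∑-δ-affine-≢ a≢a′ u u′ = trans (∑-cong (allFin q) λ b → δ-cong _≟ᶠ_ _≟ᶠ_ (affine-root-unique a≢a′ u u′ b))
                                 (allFin-enumerates q (affine-root a≢a′ u u′))

  ∑-δ-affine-≡ : ∀ a u u′ → (∑[ b ∈ allFin q ] δᶠ (b *ᶠ a +ᶠ u) (b *ᶠ a +ᶠ u′)) ≡ q * δᶠ u u′
  ∑-δ-affine-≡ a u u′ = trans (∑-cong (allFin q) λ b → δ-cong _≟ᶠ_ _≟ᶠ_ (mk⇔ (∙-cancelˡ _ _ _) (cong (b *ᶠ a +ᶠ_))))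
                              (∑-allFin-const q _)

  dotAgreements : {d : ℕ} → Point q d → Point q d → ℕ
  dotAgreements {d} y y′ = ∑[ x ∈ points q d ] δᶠ (dot F x y) (dot F x y′)

  dotAgreements-refl : ∀ {d} (y : Point q d) → dotAgreements y y ≡ q ^ d
  dotAgreements-refl {d} y = begin
    dotAgreements y y             ≡⟨ ∑-cong (points q d) (λ x → δ-refl _≟ᶠ_ (dot F x y)) ⟩
    (∑[ x ∈ points q d ] 1)       ≡⟨ ∑-points-const q d 1 ⟩
    q ^ d * 1                     ≡⟨ *-identityʳ (q ^ d) ⟩
    q ^ d                         ∎
    where open ≡-Reasoning

  -- {x : x · (y - y′) = 0} is a hyperplane: induct on d, solving for the first coordinate of x.
  q*dotAgreements-≢ : ∀ {d} (y y′ : Point q d) → y ≢ y′ → q * dotAgreements y y′ ≡ q ^ d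
  q*dotAgreements-≢ [] [] []≢[] = contradiction refl []≢[]
  q*dotAgreements-≢ {suc d} (a ∷ y) (a′ ∷ y′) a∷y≢a′∷y′ with a ≟ᶠ a′
  ... | no a≢a′ = cong (q *_) (begin
    dotAgreements (a ∷ y) (a′ ∷ y′)
      ≡⟨ ∑-allVec-suc (allFin q) d _ ⟩
    (∑[ x ∈ points q d ] ∑[ b ∈ allFin q ] δᶠ (b *ᶠ a +ᶠ dot F x y) (b *ᶠ a′ +ᶠ dot F x y′))
      ≡⟨ ∑-cong (points q d) (λ x → ∑-δ-affine-≢ a≢a′ _ _) ⟩
    (∑[ x ∈ points q d ] 1)
      ≡⟨ ∑-points-const q d 1 ⟩
    q ^ d * 1
      ≡⟨ *-identityʳ (q ^ d) ⟩
    q ^ d ∎)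
    where open ≡-Reasoning
  ... | yes refl = begin
    q * dotAgreements (a ∷ y) (a ∷ y′)
      ≡⟨ cong (q *_) (∑-allVec-suc (allFin q) d _) ⟩
    q * (∑[ x ∈ points q d ] ∑[ b ∈ allFin q ] δᶠ (b *ᶠ a +ᶠ dot F x y) (b *ᶠ a +ᶠ dot F x y′))
      ≡⟨ cong (q *_) (∑-cong (points q d) (λ x → ∑-δ-affine-≡ a _ _)) ⟩
    q * (∑[ x ∈ points q d ] q * δᶠ (dot F x y) (dot F x y′))
      ≡⟨ cong (q *_) (*-distribˡ-∑ q (points q d) _) ⟨
    q * (q * dotAgreements y y′)
      ≡⟨ cong (q *_) (q*dotAgreements-≢ y y′ (a∷y≢a′∷y′ ∘ cong (a ∷_))) ⟩
    q * q ^ d ∎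
    where open ≡-Reasoning

  q*dotAgreements≤ : ∀ {d} (y y′ : Point q d) → q * dotAgreements y y′ ≤ q ^ d + q ^ suc d * δᵛ y y′
  q*dotAgreements≤ {d} y y′ with ≡-dec _≟ᶠ_ y y′
  ... | yes refl = ≤-trans (≤-reflexive (trans (cong (q *_) (dotAgreements-refl y)) (sym (*-identityʳ (q ^ suc d)))))
                           (m≤n+m _ (q ^ d))
  ... | no y≢y′  = ≤-trans (≤-reflexive (q*dotAgreements-≢ y y′ y≢y′)) (m≤m+n (q ^ d) _)

-- Additive energy of maps on F_q^d

module _ {q d : ℕ} where

  private
    pts : List (Point q d)
    pts = points q d

  collision : {m : ℕ} → (Point q d → Bool) → (Point q d → Point q m) → Point q d → Point q d → ℕ
  collision U ψ y y′ = 𝟙 (U y) * 𝟙 (U y′) * δᵛ (ψ y) (ψ y′)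

  energy : {m : ℕ} → (Point q d → Bool) → (Point q d → Point q m) → ℕ
  energy U ψ = ∑[ y ∈ pts ] ∑[ y′ ∈ pts ] collision U ψ y y′

  fibre : {m : ℕ} → (Point q d → Bool) → (Point q d → Point q m) → Point q m → ℕ
  fibre U ψ z = ∑[ y ∈ pts ] δᵛ z (ψ y) * 𝟙 (U y)

  ∑-fibre : ∀ {m} (U : Point q d → Bool) (ψ : Point q d → Point q m) →
            (∑[ z ∈ points q m ] fibre U ψ z) ≡ ∣ U ∣ₚ
  ∑-fibre {m} U ψ = begin
    (∑[ z ∈ points q m ] fibre U ψ z)                            ≡⟨ ∑-comm (points q m) pts _ ⟩
    (∑[ y ∈ pts ] ∑[ z ∈ points q m ] δᵛ z (ψ y) * 𝟙 (U y))      ≡⟨ ∑-cong pts (λ y → ∑-δᵛ (ψ y) (λ _ → 𝟙 (U y))) ⟩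
    ∑ pts (𝟙 ∘ U)                                                 ≡⟨ card≡∑𝟙 pts U ⟨
    ∣ U ∣ₚ                                                        ∎
    where open ≡-Reasoning

  ∑-fibre² : ∀ {m} (U : Point q d → Bool) (ψ : Point q d → Point q m) →
             (∑[ z ∈ points q m ] fibre U ψ z * fibre U ψ z) ≡ energy U ψ
  ∑-fibre² {m} U ψ = begin
    (∑[ z ∈ points q m ] fibre U ψ z * fibre U ψ z)
      ≡⟨ ∑-cong (points q m) (λ z → ∑*∑ pts pts _ _) ⟩
    (∑[ z ∈ points q m ] ∑[ y ∈ pts ] ∑[ y′ ∈ pts ] N z y * N z y′)
      ≡⟨ trans (∑-comm (points q m) pts _) (∑-cong pts λ y → ∑-comm (points q m) pts _) ⟩
    (∑[ y ∈ pts ] ∑[ y′ ∈ pts ] ∑[ z ∈ points q m ] N z y * N z y′)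
      ≡⟨ ∑-cong pts (λ y → ∑-cong pts (common-fibres y)) ⟩
    energy U ψ ∎
    where
    open ≡-Reasoning
    N : Point q m → Point q d → ℕ
    N z y = δᵛ z (ψ y) * 𝟙 (U y)
    regroup : ∀ a s b t → a * s * (b * t) ≡ a * (b * (s * t))
    regroup = solve-∀
    common-fibres : ∀ y y′ → (∑[ z ∈ points q m ] N z y * N z y′) ≡ collision U ψ y y′
    common-fibres y y′ = begin
      (∑[ z ∈ points q m ] N z y * N z y′)
        ≡⟨ ∑-cong (points q m) (λ z → regroup (δᵛ z (ψ y)) (𝟙 (U y)) (δᵛ z (ψ y′)) (𝟙 (U y′))) ⟩
      (∑[ z ∈ points q m ] δᵛ z (ψ y) * (δᵛ z (ψ y′) * (𝟙 (U y) * 𝟙 (U y′))))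
        ≡⟨ ∑-δᵛ (ψ y) (λ z → δᵛ z (ψ y′) * (𝟙 (U y) * 𝟙 (U y′))) ⟩
      δᵛ (ψ y) (ψ y′) * (𝟙 (U y) * 𝟙 (U y′))
        ≡⟨ *-comm (δᵛ (ψ y) (ψ y′)) _ ⟩
      collision U ψ y y′ ∎

  -- Cauchy–Schwarz on the fibres of ψ, which vanish outside the image I.
  card²≤image*energy : ∀ {m} (U : Point q d → Bool) (ψ : Point q d → Point q m) (I : Point q m → Bool) →
    (∀ z → I z ≡ false → fibre U ψ z ≡ 0) → ∣ U ∣ₚ * ∣ U ∣ₚ ≤ ∣ I ∣ₚ * energy U ψ
  card²≤image*energy {m} U ψ I outside = begin
    ∣ U ∣ₚ * ∣ U ∣ₚ
      ≡⟨ cong (λ t → t * t) (∑-fibre U ψ) ⟨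
    ∑ (points q m) (fibre U ψ) * ∑ (points q m) (fibre U ψ)
      ≤⟨ cauchy-schwarz (points q m) I (fibre U ψ) outside ⟩
    ∑ (points q m) (𝟙 ∘ I) * (∑[ z ∈ points q m ] fibre U ψ z * fibre U ψ z)
      ≡⟨ cong₂ _*_ (sym (card≡∑𝟙 (points q m) I)) (∑-fibre² U ψ) ⟩
    ∣ I ∣ₚ * energy U ψ ∎
    where open ≤-Reasoning

  energy-mono : ∀ {m} {U U′ : Point q d → Bool} (ψ : Point q d → Point q m) → U ⊆ U′ → energy U ψ ≤ energy U′ ψ
  energy-mono {U = U} {U′} ψ U⊆U′ = ∑-mono-≤ pts λ y → ∑-mono-≤ pts λ y′ →
    *-monoˡ-≤ (δᵛ (ψ y) (ψ y′)) (*-mono-≤ (𝟙-mono (U⊆U′ y)) (𝟙-mono (U⊆U′ y′)))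

  energy-[] : (U : Point q d → Bool) → energy U (λ _ → []) ≡ ∣ U ∣ₚ * ∣ U ∣ₚ
  energy-[] U = begin
    energy U (λ _ → [])                               ≡⟨ ∑-cong pts (λ y → ∑-cong pts λ y′ → *-identityʳ _) ⟩
    (∑[ y ∈ pts ] ∑[ y′ ∈ pts ] 𝟙 (U y) * 𝟙 (U y′))   ≡⟨ ∑*∑ pts pts (𝟙 ∘ U) (𝟙 ∘ U) ⟨
    ∑ pts (𝟙 ∘ U) * ∑ pts (𝟙 ∘ U)                     ≡⟨ cong (λ t → t * t) (card≡∑𝟙 pts U) ⟨
    ∣ U ∣ₚ * ∣ U ∣ₚ                                   ∎
    where open ≡-Reasoning

  fibre-∷ : ∀ {m} (U : Point q d → Bool) (χ : Point q d → Fin q) (ψ : Point q d → Point q m) (z : Point q m) →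
            (∑[ c ∈ allFin q ] fibre U (λ y → χ y ∷ ψ y) (c ∷ z)) ≡ fibre U ψ z
  fibre-∷ U χ ψ z = begin
    (∑[ c ∈ allFin q ] ∑[ y ∈ pts ] δᵛ (c ∷ z) (χ y ∷ ψ y) * 𝟙 (U y))
      ≡⟨ ∑-comm (allFin q) pts _ ⟩
    (∑[ y ∈ pts ] ∑[ c ∈ allFin q ] δᵛ (c ∷ z) (χ y ∷ ψ y) * 𝟙 (U y))
      ≡⟨ ∑-cong pts (λ y → ∑-cong (allFin q) λ c → split c y) ⟩
    (∑[ y ∈ pts ] ∑[ c ∈ allFin q ] δᶠ c (χ y) * (δᵛ z (ψ y) * 𝟙 (U y)))
      ≡⟨ ∑-cong pts (λ y → ∑-δᶠ (χ y) _) ⟩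
    fibre U ψ z ∎
    where
    open ≡-Reasoning
    split : ∀ c y → δᵛ (c ∷ z) (χ y ∷ ψ y) * 𝟙 (U y) ≡ δᶠ c (χ y) * (δᵛ z (ψ y) * 𝟙 (U y))
    split c y = trans (cong (_* 𝟙 (U y)) (δ-∷ _≟ᶠ_ c (χ y) z (ψ y))) (*-assoc (δᶠ c (χ y)) _ _)

  -- Cauchy–Schwarz on each group of q fibres of χ ∷ ψ lying over a fibre of ψ.
  energy≤q*energy-∷ : ∀ {m} (U : Point q d → Bool) (χ : Point q d → Fin q) (ψ : Point q d → Point q m) →
                      energy U ψ ≤ q * energy U (λ y → χ y ∷ ψ y)
  energy≤q*energy-∷ {m} U χ ψ = begin
    energy U ψ
      ≡⟨ ∑-fibre² U ψ ⟨
    (∑[ z ∈ points q m ] fibre U ψ z * fibre U ψ z)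
      ≡⟨ ∑-cong (points q m) (λ z → cong (λ t → t * t) (fibre-∷ U χ ψ z)) ⟨
    (∑[ z ∈ points q m ] ∑ (allFin q) (N ∘ (_∷ z)) * ∑ (allFin q) (N ∘ (_∷ z)))
      ≤⟨ ∑-mono-≤ (points q m) (λ z → cauchy-schwarz (allFin q) (λ _ → true) (N ∘ (_∷ z)) (λ _ ())) ⟩
    (∑[ z ∈ points q m ] (∑[ c ∈ allFin q ] 1) * (∑[ c ∈ allFin q ] N (c ∷ z) * N (c ∷ z)))
      ≡⟨ ∑-cong (points q m) (λ z → cong (_* ∑ (allFin q) (λ c → N (c ∷ z) * N (c ∷ z)))
                                           (trans (∑-allFin-const q 1) (*-identityʳ q))) ⟩
    (∑[ z ∈ points q m ] q * (∑[ c ∈ allFin q ] N (c ∷ z) * N (c ∷ z)))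
      ≡⟨ *-distribˡ-∑ q (points q m) _ ⟨
    q * (∑[ z ∈ points q m ] ∑[ c ∈ allFin q ] N (c ∷ z) * N (c ∷ z))
      ≡⟨ cong (q *_) (∑-allVec-suc (allFin q) m (λ w → N w * N w)) ⟨
    q * (∑[ w ∈ points q (suc m) ] N w * N w)
      ≡⟨ cong (q *_) (∑-fibre² U (λ y → χ y ∷ ψ y)) ⟩
    q * energy U (λ y → χ y ∷ ψ y) ∎
    where
    open ≤-Reasoning
    N : Point q (suc m) → ℕ
    N = fibre U (λ y → χ y ∷ ψ y)

  energy-∷ : ∀ {m} (U : Point q d → Bool) (χ : Point q d → Fin q) (ψ : Point q d → Point q m) →
             energy U (λ y → χ y ∷ ψ y) ≡ (∑[ y ∈ pts ] ∑[ y′ ∈ pts ] δᶠ (χ y) (χ y′) * collision U ψ y y′)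
  energy-∷ U χ ψ = ∑-cong pts λ y → ∑-cong pts λ y′ →
    trans (cong (𝟙 (U y) * 𝟙 (U y′) *_) (δ-∷ _≟ᶠ_ (χ y) (χ y′) (ψ y) (ψ y′)))
          (regroup (𝟙 (U y) * 𝟙 (U y′)) (δᶠ (χ y) (χ y′)) (δᵛ (ψ y) (ψ y′)))
    where
    regroup : ∀ t c v → t * (c * v) ≡ c * (t * v)
    regroup = solve-∀

  ∑-δ*collision : ∀ {m} (U : Point q d → Bool) (ψ : Point q d → Point q m) →
                  (∑[ y ∈ pts ] ∑[ y′ ∈ pts ] δᵛ y y′ * collision U ψ y y′) ≡ ∣ U ∣ₚ
  ∑-δ*collision U ψ = begin
    (∑[ y ∈ pts ] ∑[ y′ ∈ pts ] δᵛ y y′ * collision U ψ y y′)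
      ≡⟨ ∑-cong pts (λ y → ∑-cong pts λ y′ → cong (_* collision U ψ y y′) (δ-sym (≡-dec _≟ᶠ_) y y′)) ⟩
    (∑[ y ∈ pts ] ∑[ y′ ∈ pts ] δᵛ y′ y * collision U ψ y y′)
      ≡⟨ ∑-cong pts (λ y → ∑-δᵛ y (collision U ψ y)) ⟩
    (∑[ y ∈ pts ] collision U ψ y y)
      ≡⟨ ∑-cong pts diagonal ⟩
    ∑ pts (𝟙 ∘ U)
      ≡⟨ card≡∑𝟙 pts U ⟨
    ∣ U ∣ₚ ∎
    where
    open ≡-Reasoning
    diagonal : ∀ y → collision U ψ y y ≡ 𝟙 (U y)
    diagonal y = trans (cong (𝟙 (U y) * 𝟙 (U y) *_) (δ-refl (≡-dec _≟ᶠ_) (ψ y)))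
                       (trans (*-identityʳ _) (𝟙-idem (U y)))

-- Averaging energies over dot-product maps

module _ {q : ℕ} (F : FiniteField q) where

  private instance
    q-nonZero : NonZero q
    q-nonZero = nonZeroIndex (FiniteField.0ᶠ F)

  dots : ∀ {d n} → Vec (Point q d) n → Point q d → Point q n
  dots x y = Vec.map (λ xᵢ → dot F xᵢ y) x

  ∑-energy-dot∷ : ∀ {d m} (U : Point q d → Bool) (ψ : Point q d → Point q m) →
    (∑[ x ∈ points q d ] q * energy U (λ y → dot F x y ∷ ψ y)) ≤ q ^ d * energy U ψ + q ^ suc d * ∣ U ∣ₚ
  ∑-energy-dot∷ {d} U ψ = begin
    (∑[ x ∈ pts ] q * energy U (λ y → dot F x y ∷ ψ y))
      ≡⟨ *-distribˡ-∑ q pts _ ⟨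
    q * (∑[ x ∈ pts ] energy U (λ y → dot F x y ∷ ψ y))
      ≡⟨ cong (q *_) (∑-cong pts λ x → energy-∷ U (dot F x) ψ) ⟩
    q * (∑[ x ∈ pts ] ∑[ y ∈ pts ] ∑[ y′ ∈ pts ] δᶠ (dot F x y) (dot F x y′) * c y y′)
      ≡⟨ cong (q *_) (trans (∑-comm pts pts _) (∑-cong pts λ y → ∑-comm pts pts _)) ⟩
    q * (∑[ y ∈ pts ] ∑[ y′ ∈ pts ] ∑[ x ∈ pts ] δᶠ (dot F x y) (dot F x y′) * c y y′)
      ≡⟨ cong (q *_) (∑-cong pts λ y → ∑-cong pts λ y′ → *-distribʳ-∑ (c y y′) pts _) ⟨
    q * (∑[ y ∈ pts ] ∑[ y′ ∈ pts ] dotAgreements F y y′ * c y y′)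
      ≡⟨ trans (*-distribˡ-∑ q pts _) (∑-cong pts λ y → *-distribˡ-∑ q pts _) ⟩
    (∑[ y ∈ pts ] ∑[ y′ ∈ pts ] q * (dotAgreements F y y′ * c y y′))
      ≤⟨ ∑-mono-≤ pts (λ y → ∑-mono-≤ pts (pointwise y)) ⟩
    (∑[ y ∈ pts ] ∑[ y′ ∈ pts ] q ^ d * c y y′ + q ^ suc d * (δᵛ y y′ * c y y′))
      ≡⟨ trans (∑-cong pts λ y → ∑-distrib-+ pts _ _) (∑-distrib-+ pts _ _) ⟩
    (∑[ y ∈ pts ] ∑[ y′ ∈ pts ] q ^ d * c y y′) + (∑[ y ∈ pts ] ∑[ y′ ∈ pts ] q ^ suc d * (δᵛ y y′ * c y y′))
      ≡⟨ cong₂ _+_ (*-distribˡ-∑∑ (q ^ d) _) (*-distribˡ-∑∑ (q ^ suc d) _) ⟨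
    q ^ d * energy U ψ + q ^ suc d * (∑[ y ∈ pts ] ∑[ y′ ∈ pts ] δᵛ y y′ * c y y′)
      ≡⟨ cong (λ s → q ^ d * energy U ψ + q ^ suc d * s) (∑-δ*collision U ψ) ⟩
    q ^ d * energy U ψ + q ^ suc d * ∣ U ∣ₚ ∎
    where
    open ≤-Reasoning
    pts : List (Point q d)
    pts = points q d
    c : Point q d → Point q d → ℕ
    c = collision U ψ
    *-distribˡ-∑∑ : ∀ k (f : Point q d → Point q d → ℕ) →
                    k * (∑[ y ∈ pts ] ∑[ y′ ∈ pts ] f y y′) ≡ (∑[ y ∈ pts ] ∑[ y′ ∈ pts ] k * f y y′)
    *-distribˡ-∑∑ k f = trans (*-distribˡ-∑ k pts _) (∑-cong pts λ y → *-distribˡ-∑ k pts (f y))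
    pointwise : ∀ y y′ → q * (dotAgreements F y y′ * c y y′) ≤ q ^ d * c y y′ + q ^ suc d * (δᵛ y y′ * c y y′)
    pointwise y y′ = begin
      q * (dotAgreements F y y′ * c y y′)      ≡⟨ *-assoc q _ _ ⟨
      q * dotAgreements F y y′ * c y y′        ≤⟨ *-monoˡ-≤ (c y y′) (q*dotAgreements≤ F y y′) ⟩
      (q ^ d + q ^ suc d * δᵛ y y′) * c y y′   ≡⟨ distrib (q ^ d) (q ^ suc d) (δᵛ y y′) (c y y′) ⟩
      q ^ d * c y y′ + q ^ suc d * (δᵛ y y′ * c y y′) ∎
      where
      distrib : ∀ a b δ c → (a + b * δ) * c ≡ a * c + b * (δ * c)
      distrib = solve-∀

  ∑-energy-dot∷-restricted : ∀ {d m} (A₀ U : Point q d → Bool) (ψ : Point q d → Point q m) →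
    (∑[ x ∈ points q d ] 𝟙 (A₀ x) * (q * energy U (λ y → dot F x y ∷ ψ y)))
      ≤ ∣ A₀ ∣ₚ * energy U ψ + q ^ suc d * ∣ U ∣ₚ
  ∑-energy-dot∷-restricted {d} A₀ U ψ = begin
    (∑[ x ∈ pts ] 𝟙 (A₀ x) * f x)          ≤⟨ ∑-restrict-≤ pts A₀ f (λ x → energy≤q*energy-∷ U (dot F x) ψ) average ⟩
    ∑ pts (𝟙 ∘ A₀) * energy U ψ + R        ≡⟨ cong (λ a → a * energy U ψ + R) (card≡∑𝟙 pts A₀) ⟨
    ∣ A₀ ∣ₚ * energy U ψ + R               ∎
    where
    open ≤-Reasoning
    pts : List (Point q d)
    pts = points q d
    R : ℕ
    R = q ^ suc d * ∣ U ∣ₚ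
    f : Point q d → ℕ
    f x = q * energy U (λ y → dot F x y ∷ ψ y)
    average : ∑ pts f ≤ length pts * energy U ψ + R
    average = subst (λ l → ∑ pts f ≤ l * energy U ψ + R) (sym (length-points q d)) (∑-energy-dot∷ U ψ)

  boxEnergy : ∀ {d n} → (Fin n → Point q d → Bool) → (Point q d → Bool) → ℕ
  boxEnergy {d} {n} A B = ∑[ x ∈ tuples q d n ] 𝟙 (box A x) * energy B (dots x)

  q*boxEnergy≤ : ∀ {d n} (A : Fin (suc n) → Point q d → Bool) (B : Point q d → Bool) →
    q * boxEnergy A B ≤ ∣ A zero ∣ₚ * boxEnergy (A ∘ suc) B + q ^ suc d * ∣ B ∣ₚ * ∏ n (λ i → ∣ A (suc i) ∣ₚ)
  q*boxEnergy≤ {d} {n} A B = begin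
    q * boxEnergy A B
      ≡⟨ cong (q *_) (∑-allVec-suc pts n _) ⟩
    q * (∑[ v ∈ tuples q d n ] ∑[ x ∈ pts ] 𝟙 (A zero x ∧ box A′ v) * E x v)
      ≡⟨ trans (*-distribˡ-∑ q (tuples q d n) _) (∑-cong (tuples q d n) factor) ⟩
    (∑[ v ∈ tuples q d n ] 𝟙 (box A′ v) * (∑[ x ∈ pts ] 𝟙 (A zero x) * (q * E x v)))
      ≤⟨ ∑-mono-≤ (tuples q d n) (λ v → *-monoʳ-≤ (𝟙 (box A′ v)) (∑-energy-dot∷-restricted (A zero) B (dots v))) ⟩
    (∑[ v ∈ tuples q d n ] 𝟙 (box A′ v) * (∣ A zero ∣ₚ * energy B (dots v) + R))
      ≡⟨ ∑-cong (tuples q d n) (λ v → spread (𝟙 (box A′ v)) ∣ A zero ∣ₚ (energy B (dots v)) R) ⟩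
    (∑[ v ∈ tuples q d n ] ∣ A zero ∣ₚ * (𝟙 (box A′ v) * energy B (dots v)) + R * 𝟙 (box A′ v))
      ≡⟨ ∑-distrib-+ (tuples q d n) _ _ ⟩
    (∑[ v ∈ tuples q d n ] ∣ A zero ∣ₚ * (𝟙 (box A′ v) * energy B (dots v)))
      + (∑[ v ∈ tuples q d n ] R * 𝟙 (box A′ v))
      ≡⟨ cong₂ _+_ (*-distribˡ-∑ ∣ A zero ∣ₚ (tuples q d n) _)
                   (trans (cong (R *_) (sym (∑-box pts n A′))) (*-distribˡ-∑ R (tuples q d n) _)) ⟨
    ∣ A zero ∣ₚ * boxEnergy A′ B + R * ∏ n (λ i → ∣ A′ i ∣ₚ) ∎
    where
    open ≤-Reasoning
    pts : List (Point q d)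
    pts = points q d
    A′ : Fin n → Point q d → Bool
    A′ = A ∘ suc
    R : ℕ
    R = q ^ suc d * ∣ B ∣ₚ
    E : Point q d → Vec (Point q d) n → ℕ
    E x v = energy B (dots (x ∷ v))
    factor : ∀ v → q * (∑[ x ∈ pts ] 𝟙 (A zero x ∧ box A′ v) * E x v)
                 ≡ 𝟙 (box A′ v) * (∑[ x ∈ pts ] 𝟙 (A zero x) * (q * E x v))
    factor v = trans (*-distribˡ-∑ q pts _) (trans (∑-cong pts regroup) (sym (*-distribˡ-∑ (𝟙 (box A′ v)) pts _)))
      where
      swap : ∀ q a b e → q * (a * b * e) ≡ b * (a * (q * e))
      swap = solve-∀
      regroup : ∀ x → q * (𝟙 (A zero x ∧ box A′ v) * E x v) ≡ 𝟙 (box A′ v) * (𝟙 (A zero x) * (q * E x v))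
      regroup x = trans (cong (λ t → q * (t * E x v)) (𝟙-∧ (A zero x) (box A′ v)))
                        (swap q (𝟙 (A zero x)) (𝟙 (box A′ v)) (E x v))
    spread : ∀ b a e r → b * (a * e + r) ≡ a * (b * e) + r * b
    spread = solve-∀

  -- Induction on n: each new coordinate x₀ ∈ A₀ costs a factor q in energy, but the error term
  -- q^(d+1) |B| it produces is paid for by the hypothesis on |A₀| |B|.
  boxEnergy-bound : ∀ {d} n (A : Fin n → Point q d → Bool) (B : Point q d → Bool) →
    (∀ i → q ^ (d + n) ≤ ∣ A i ∣ₚ * ∣ B ∣ₚ) →
    q ^ n * boxEnergy A B ≤ suc n * ∏ n (λ i → ∣ A i ∣ₚ) * (∣ B ∣ₚ * ∣ B ∣ₚ)
  boxEnergy-bound zero A B _ = ≤-reflexive (trans (unit (energy B (λ _ → []))) (cong (1 * 1 *_) (energy-[] B)))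
    where
    unit : ∀ e → 1 * (1 * e + 0) ≡ 1 * 1 * e
    unit = solve-∀
  boxEnergy-bound {d} (suc n) A B bigA = begin
    q ^ suc n * boxEnergy A B
      ≡⟨ swap q (q ^ n) (boxEnergy A B) ⟩
    q ^ n * (q * boxEnergy A B)
      ≤⟨ *-monoʳ-≤ (q ^ n) (q*boxEnergy≤ A B) ⟩
    q ^ n * (a₀ * boxEnergy A′ B + q ^ suc d * b * P′)
      ≡⟨ spread (q ^ n) a₀ (boxEnergy A′ B) (q ^ suc d) b P′ ⟩
    a₀ * (q ^ n * boxEnergy A′ B) + q ^ suc d * q ^ n * b * P′
      ≡⟨ cong (λ t → a₀ * (q ^ n * boxEnergy A′ B) + t * b * P′) powers ⟩
    a₀ * (q ^ n * boxEnergy A′ B) + q ^ (d + suc n) * b * P′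
      ≤⟨ +-mono-≤ (*-monoʳ-≤ a₀ (boxEnergy-bound n A′ B bigA′)) (*-monoˡ-≤ P′ (*-monoˡ-≤ b (bigA zero))) ⟩
    a₀ * (suc n * P′ * (b * b)) + a₀ * b * b * P′
      ≡⟨ collect n a₀ P′ b ⟩
    suc (suc n) * (a₀ * P′) * (b * b)
      ≡⟨ cong (λ p → suc (suc n) * p * (b * b)) (∏-suc n (λ i → ∣ A i ∣ₚ)) ⟨
    suc (suc n) * ∏ (suc n) (λ i → ∣ A i ∣ₚ) * (b * b) ∎
    where
    open ≤-Reasoning
    A′ : Fin n → Point q d → Bool
    A′ = A ∘ suc
    a₀ b P′ : ℕ
    a₀ = ∣ A zero ∣ₚ
    b = ∣ B ∣ₚ
    P′ = ∏ n (λ i → ∣ A′ i ∣ₚ)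
    bigA′ : ∀ i → q ^ (d + n) ≤ ∣ A′ i ∣ₚ * b
    bigA′ i = ≤-trans (^-monoʳ-≤ q (+-monoʳ-≤ d (n≤1+n n))) (bigA (suc i))
    powers : q ^ suc d * q ^ n ≡ q ^ (d + suc n)
    powers = trans (sym (^-distribˡ-+-* q (suc d) n)) (cong (q ^_) (sym (+-suc d n)))
    swap : ∀ q p m → q * p * m ≡ p * (q * m)
    swap = solve-∀
    spread : ∀ p a m r b c → p * (a * m + r * b * c) ≡ a * (p * m) + r * p * b * c
    spread = solve-∀
    collect : ∀ n a p b → a * (suc n * p * (b * b)) + a * b * b * p ≡ suc (suc n) * (a * p) * (b * b)
    collect = solve-∀

-- Fibres of S and their projections

module FibreProjections {q d ℓ : ℕ} (F : FiniteField q)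
         (A : Fin (suc ℓ) → Point q d → Bool) (S : Vec (Point q d) (suc ℓ) → Bool)
         (S⊆∏A : ∀ t → T (S t) → (i : Fin (suc ℓ)) → T (A i (lookup t i))) where

  private
    pts : List (Point q d)
    pts = points q d
    B : Point q d → Bool
    B = A (fromℕ ℓ)
    A′ : Fin ℓ → Point q d → Bool
    A′ = A ∘ inject₁

  S[_] : Vec (Point q d) ℓ → Point q d → Bool
  S[ x ] y = B y ∧ S (x ∷ʳ y)

  S⇒B : ∀ x y → T (S (x ∷ʳ y)) → T (B y)
  S⇒B x y s = subst (T ∘ B) (lookup-∷ʳ-fromℕ x y) (S⊆∏A (x ∷ʳ y) s (fromℕ ℓ))

  S⇒box : ∀ x y → T (S (x ∷ʳ y)) → T (box A′ x)
  S⇒box x y s = box-intro A′ x λ i → subst (T ∘ A′ i) (lookup-∷ʳ-inject₁ x y i) (S⊆∏A (x ∷ʳ y) s (inject₁ i))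

  ∣S∣≡∑∣S[x]∣ : ∣ S ∣ₜ ≡ (∑[ x ∈ tuples q d ℓ ] ∣ S[ x ] ∣ₚ)
  ∣S∣≡∑∣S[x]∣ = begin
    ∣ S ∣ₜ                                                  ≡⟨ card≡∑𝟙 (tuples q d (suc ℓ)) S ⟩
    ∑ (tuples q d (suc ℓ)) (𝟙 ∘ S)                          ≡⟨ ∑-allVec-snoc pts ℓ _ ⟩
    (∑[ x ∈ tuples q d ℓ ] ∑[ y ∈ pts ] 𝟙 (S (x ∷ʳ y)))     ≡⟨ ∑-cong (tuples q d ℓ) fibre-card ⟩
    (∑[ x ∈ tuples q d ℓ ] ∣ S[ x ] ∣ₚ)                     ∎
    where
    open ≡-Reasoning
    fibre-card : ∀ x → (∑[ y ∈ pts ] 𝟙 (S (x ∷ʳ y))) ≡ ∣ S[ x ] ∣ₚ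
    fibre-card x = trans (∑-cong pts λ y → sym (𝟙-∧-absorbˡ (S⇒B x y))) (sym (card≡∑𝟙 pts S[ x ]))

  ∣S[x]∣≤ : ∀ x → ∣ S[ x ] ∣ₚ ≤ 𝟙 (box A′ x) * ∣ B ∣ₚ
  ∣S[x]∣≤ x = begin
    ∣ S[ x ] ∣ₚ                                  ≡⟨ card≡∑𝟙 pts S[ x ] ⟩
    ∑ pts (𝟙 ∘ S[ x ])                           ≤⟨ ∑-mono-≤ pts (λ y → 𝟙-mono (inside y)) ⟩
    (∑[ y ∈ pts ] 𝟙 (box A′ x ∧ B y))            ≡⟨ ∑-cong pts (λ y → 𝟙-∧ (box A′ x) (B y)) ⟩
    (∑[ y ∈ pts ] 𝟙 (box A′ x) * 𝟙 (B y))        ≡⟨ *-distribˡ-∑ (𝟙 (box A′ x)) pts (𝟙 ∘ B) ⟨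
    𝟙 (box A′ x) * ∑ pts (𝟙 ∘ B)                 ≡⟨ cong (𝟙 (box A′ x) *_) (card≡∑𝟙 pts B) ⟨
    𝟙 (box A′ x) * ∣ B ∣ₚ                        ∎
    where
    open ≤-Reasoning
    inside : ∀ y → T (S[ x ] y) → T (box A′ x ∧ B y)
    inside y y∈S[x] = let (b , s) = Equivalence.to T-∧ y∈S[x] in Equivalence.from T-∧ (S⇒box x y s , b)

  ∣S[x]∣²≤∣Π∣*energy : ∀ x → ∣ S[ x ] ∣ₚ * ∣ S[ x ] ∣ₚ ≤ ∣ Π F A S x ∣ₚ * energy B (dots F x)
  ∣S[x]∣²≤∣Π∣*energy x =
    ≤-trans (card²≤image*energy S[ x ] (dots F x) (Π F A S x) outside)
            (*-monoʳ-≤ ∣ Π F A S x ∣ₚ (energy-mono {U = S[ x ]} {B} (dots F x) (λ y → proj₁ ∘ Equivalence.to T-∧)))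
    where
    outside : ∀ z → Π F A S x z ≡ false → fibre S[ x ] (dots F x) z ≡ 0
    outside z = any-false⇒∑≡0 pts _ _ term
      where
      term : ∀ y → (B y ∧ S (x ∷ʳ y) ∧ ⌊ ≡-dec _≟ᶠ_ z (dots F x y) ⌋) ≡ false → δᵛ z (dots F x y) * 𝟙 (S[ x ] y) ≡ 0
      term y with B y | S (x ∷ʳ y) | ≡-dec _≟ᶠ_ z (dots F x y)
      ... | false | _     | dec    = λ _ → *-zeroʳ (𝟙 (does dec))
      ... | true  | false | dec    = λ _ → *-zeroʳ (𝟙 (does dec))
      ... | true  | true  | no _   = λ _ → refl
      ... | true  | true  | yes _  = λ ()

  nonempty-fibre⇒S′ : ∀ x → 0 < ∣ S[ x ] ∣ₚ → T (S′ F A S x)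
  nonempty-fibre⇒S′ x pos = ∑𝟙>0⇒any pts S[ x ] (subst (0 <_) (card≡∑𝟙 pts S[ x ]) pos)

  module LargeProjections .{{_ : NonZero ℓ}} (K : ℕ)
           (S-dense : ∏ (suc ℓ) (λ i → ∣ A i ∣ₚ) ≤ K * ∣ S ∣ₜ)
           (A-large : (i : Fin ℓ) → q ^ (d + ℓ) ≤ ∣ A′ i ∣ₚ * ∣ B ∣ₚ) where

    private
      b P L : ℕ
      b = ∣ B ∣ₚ
      P = ∏ ℓ (λ i → ∣ A′ i ∣ₚ)
      L = 4 * K * suc ℓ
      instance
        q-nonZero : NonZero q
        q-nonZero = nonZeroIndex (FiniteField.0ᶠ F)
        b-nonZero : NonZero b
        b-nonZero = m*n≢0⇒n≢0 ∣ A′ i₀ ∣ₚ {{>-nonZero (<-≤-trans (m^n>0 q (d + ℓ)) (A-large i₀))}}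
          where i₀ = fromℕ< (>-nonZero⁻¹ ℓ)
        b*b-nonZero : NonZero (b * b)
        b*b-nonZero = m*n≢0 b b

    popular lowEnergy : Vec (Point q d) ℓ → Bool
    popular x = ⌊ b ≤? 2 * K * ∣ S[ x ] ∣ₚ ⌋
    lowEnergy x = ⌊ q ^ ℓ * energy B (dots F x) ≤? L * (b * b) ⌋

    S₁ : Vec (Point q d) ℓ → Bool
    S₁ x = box A′ x ∧ popular x ∧ lowEnergy x

    P≡∑box : P ≡ (∑[ x ∈ tuples q d ℓ ] 𝟙 (box A′ x))
    P≡∑box = sym (∑-box pts ℓ A′)

    P≤2K*∣popular∣ : P ≤ 2 * K * (∑[ x ∈ tuples q d ℓ ] 𝟙 (box A′ x ∧ popular x))
    P≤2K*∣popular∣ = ≤-trans (≤-reflexive P≡∑box)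
      (popular-≥ (tuples q d ℓ) (box A′) (λ x → ∣ S[ x ] ∣ₚ) b K ∣S[x]∣≤
        (subst₂ _≤_ (trans (∏-snoc ℓ (λ i → ∣ A i ∣ₚ)) (cong (_* b) P≡∑box)) (cong (K *_) ∣S∣≡∑∣S[x]∣) S-dense))

    4K*∣highEnergy∣≤P : 4 * K * (∑[ x ∈ tuples q d ℓ ] 𝟙 (box A′ x ∧ not (lowEnergy x))) ≤ P
    4K*∣highEnergy∣≤P = *-cancelʳ-≤ (4 * K * N) P (suc ℓ * (b * b)) {{m*n≢0 (suc ℓ) (b * b)}} (begin
      4 * K * N * (suc ℓ * (b * b))
        ≡⟨ reorder (4 * K) N (suc ℓ) (b * b) ⟩
      L * (b * b) * N
        ≤⟨ markov (tuples q d ℓ) (box A′) (λ x → q ^ ℓ * energy B (dots F x)) (L * (b * b)) ⟩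
      (∑[ x ∈ tuples q d ℓ ] 𝟙 (box A′ x) * (q ^ ℓ * energy B (dots F x)))
        ≡⟨ trans (∑-cong (tuples q d ℓ) λ x → *-comm3 (𝟙 (box A′ x)) (q ^ ℓ) _)
                 (sym (*-distribˡ-∑ (q ^ ℓ) (tuples q d ℓ) _)) ⟩
      q ^ ℓ * boxEnergy F A′ B
        ≤⟨ boxEnergy-bound F ℓ A′ B A-large ⟩
      suc ℓ * P * (b * b)
        ≡⟨ reorder′ (suc ℓ) P (b * b) ⟩
      P * (suc ℓ * (b * b)) ∎)
      where
      open ≤-Reasoning
      N : ℕ
      N = ∑[ x ∈ tuples q d ℓ ] 𝟙 (box A′ x ∧ not (lowEnergy x))
      reorder : ∀ k n s c → k * n * (s * c) ≡ k * s * c * n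
      reorder = solve-∀
      *-comm3 : ∀ a p e → a * (p * e) ≡ p * (a * e)
      *-comm3 = solve-∀
      reorder′ : ∀ s p c → s * p * c ≡ p * (s * c)
      reorder′ = solve-∀

    P≤4K*∣S₁∣ : P ≤ 4 * K * ∣ S₁ ∣ₜ
    P≤4K*∣S₁∣ = +-cancelʳ-≤ P P (4 * K * ∣ S₁ ∣ₜ) (begin
      P + P                               ≡⟨ double P ⟩
      2 * P                               ≤⟨ *-monoʳ-≤ 2 (≤-trans P≤2K*∣popular∣ (*-monoʳ-≤ (2 * K) split)) ⟩
      2 * (2 * K * (∣ S₁ ∣ₜ + N))         ≡⟨ expand K ∣ S₁ ∣ₜ N ⟩
      4 * K * ∣ S₁ ∣ₜ + 4 * K * N         ≤⟨ +-monoʳ-≤ (4 * K * ∣ S₁ ∣ₜ) 4K*∣highEnergy∣≤P ⟩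
      4 * K * ∣ S₁ ∣ₜ + P                 ∎)
      where
      open ≤-Reasoning
      xs : List (Vec (Point q d) ℓ)
      xs = tuples q d ℓ
      N : ℕ
      N = ∑[ x ∈ xs ] 𝟙 (box A′ x ∧ not (lowEnergy x))
      split : (∑[ x ∈ xs ] 𝟙 (box A′ x ∧ popular x)) ≤ ∣ S₁ ∣ₜ + N
      split = begin
        (∑[ x ∈ xs ] 𝟙 (box A′ x ∧ popular x))
          ≤⟨ ∑-mono-≤ xs (λ x → 𝟙-∧-≤-split (box A′ x) (popular x) (lowEnergy x)) ⟩
        (∑[ x ∈ xs ] 𝟙 (S₁ x) + 𝟙 (box A′ x ∧ not (lowEnergy x))) ≡⟨ ∑-distrib-+ xs _ _ ⟩
        ∑ xs (𝟙 ∘ S₁) + N                       ≡⟨ cong (_+ N) (card≡∑𝟙 xs S₁) ⟨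
        ∣ S₁ ∣ₜ + N                            ∎
      double : ∀ n → n + n ≡ 2 * n
      double = solve-∀
      expand : ∀ k s n → 2 * (2 * k * (s + n)) ≡ 4 * k * s + 4 * k * n
      expand = solve-∀

    S₁⇒popular×lowEnergy : ∀ x → T (S₁ x) → b ≤ 2 * K * ∣ S[ x ] ∣ₚ × q ^ ℓ * energy B (dots F x) ≤ L * (b * b)
    S₁⇒popular×lowEnergy x x∈S₁ with box A′ x | b ≤? 2 * K * ∣ S[ x ] ∣ₚ | q ^ ℓ * energy B (dots F x) ≤? L * (b * b)
    ... | true | yes b≤2Kt | yes low = b≤2Kt , low

    S₁⊆S′ : S₁ ⊆ S′ F A S
    S₁⊆S′ x x∈S₁ = nonempty-fibre⇒S′ x (>-nonZero⁻¹ ∣ S[ x ] ∣ₚ {{m*n≢0⇒n≢0 (2 * K) {{2Kt-nonZero}}}})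
      where
      b≤2Kt : b ≤ 2 * K * ∣ S[ x ] ∣ₚ
      b≤2Kt = proj₁ (S₁⇒popular×lowEnergy x x∈S₁)
      2Kt-nonZero : NonZero (2 * K * ∣ S[ x ] ∣ₚ)
      2Kt-nonZero = >-nonZero (<-≤-trans (>-nonZero⁻¹ b) b≤2Kt)

    -- Cauchy–Schwarz |S[x]|² ≤ |Π| E(x), with |S[x]| ≳ |B| by popularity and E(x) ≲ |B|²/q^ℓ.
    S₁⇒q^ℓ≤∣Π∣ : ∀ x → T (S₁ x) → q ^ ℓ ≤ 2 * K * (2 * K) * L * ∣ Π F A S x ∣ₚ
    S₁⇒q^ℓ≤∣Π∣ x x∈S₁ = *-cancelʳ-≤ (q ^ ℓ) (k² * L * π) (b * b) (begin
      q ^ ℓ * (b * b)                  ≤⟨ *-monoʳ-≤ (q ^ ℓ) (*-mono-≤ b≤2Kt b≤2Kt) ⟩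
      q ^ ℓ * (2 * K * t * (2 * K * t)) ≡⟨ regroup₁ (q ^ ℓ) (2 * K) t ⟩
      k² * (q ^ ℓ * (t * t))            ≤⟨ *-monoʳ-≤ k² (*-monoʳ-≤ (q ^ ℓ) (∣S[x]∣²≤∣Π∣*energy x)) ⟩
      k² * (q ^ ℓ * (π * E))            ≡⟨ regroup₂ k² (q ^ ℓ) π E ⟩
      k² * π * (q ^ ℓ * E)              ≤⟨ *-monoʳ-≤ (k² * π) low ⟩
      k² * π * (L * (b * b))            ≡⟨ regroup₃ k² π L (b * b) ⟩
      k² * L * π * (b * b)              ∎)
      where
      open ≤-Reasoning
      t π E k² : ℕ
      t = ∣ S[ x ] ∣ₚ
      π = ∣ Π F A S x ∣ₚ
      E = energy B (dots F x)
      k² = 2 * K * (2 * K)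
      b≤2Kt : b ≤ 2 * K * t
      b≤2Kt = proj₁ (S₁⇒popular×lowEnergy x x∈S₁)
      low : q ^ ℓ * E ≤ L * (b * b)
      low = proj₂ (S₁⇒popular×lowEnergy x x∈S₁)
      regroup₁ : ∀ p k t → p * (k * t * (k * t)) ≡ k * k * (p * (t * t))
      regroup₁ = solve-∀
      regroup₂ : ∀ k p π e → k * (p * (π * e)) ≡ k * π * (p * e)
      regroup₂ = solve-∀
      regroup₃ : ∀ k π l c → k * π * (l * c) ≡ k * l * π * c
      regroup₃ = solve-∀

corollary7 : (ℓ : ℕ) → 2 ≤ ℓ → (K : ℕ) →
    Σ ℕ λ C → (d : ℕ) → ℓ ≤ d → Σ ℕ λ K′ →
      (q : ℕ) (F : FiniteField q)
      (A : Fin (suc ℓ) → Point q d → Bool)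
      (S : Vec (Point q d) (suc ℓ) → Bool) →
      (∀ t → T (S t) → (i : Fin (suc ℓ)) → T (A i (lookup t i))) →
      ∏ (suc ℓ) (λ i → ∣ A i ∣ₚ) ≤ K * ∣ S ∣ₜ →
      ((i : Fin ℓ) → C * q ^ (d + ℓ) ≤ ∣ A (inject₁ i) ∣ₚ * ∣ A (fromℕ ℓ) ∣ₚ) →
      Σ (Vec (Point q d) ℓ → Bool) λ S₁ →
        (S₁ ⊆ S′ F A S) ×
        (∏ ℓ (λ i → ∣ A (inject₁ i) ∣ₚ) ≤ K′ * ∣ S₁ ∣ₜ) ×
        (∏ ℓ (λ i → ∣ A (inject₁ i) ∣ₚ) ≤ K′ * ∣ S′ F A S ∣ₜ) ×
        (∀ x → T (S₁ x) → q ^ ℓ ≤ K′ * ∣ Π F A S x ∣ₚ)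
-- C = 1 works.
corollary7 ℓ 2≤ℓ K = 1 , λ d _ → K′ , λ q F A S S⊆∏A S-dense A-large →
  let open FibreProjections F A S S⊆∏A
      A-large′ : (i : Fin ℓ) → q ^ (d + ℓ) ≤ ∣ A (inject₁ i) ∣ₚ * ∣ A (fromℕ ℓ) ∣ₚ
      A-large′ i = ≤-trans (≤-reflexive (sym (*-identityˡ (q ^ (d + ℓ))))) (A-large i)
      open LargeProjections {{ℓ-nonZero}} K S-dense A-large′
      P≤K′*∣S₁∣ : ∏ ℓ (λ i → ∣ A (inject₁ i) ∣ₚ) ≤ K′ * ∣ S₁ ∣ₜ
      P≤K′*∣S₁∣ = ≤-trans P≤4K*∣S₁∣ (*-monoˡ-≤ ∣ S₁ ∣ₜ (m≤m+n (4 * K) _))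
  in S₁ , S₁⊆S′ , P≤K′*∣S₁∣ , ≤-trans P≤K′*∣S₁∣ (*-monoʳ-≤ K′ (card-mono (tuples q d ℓ) S₁⊆S′)) ,
     λ x x∈S₁ → ≤-trans (S₁⇒q^ℓ≤∣Π∣ x x∈S₁) (*-monoˡ-≤ ∣ Π F A S x ∣ₚ (m≤n+m _ (4 * K)))
  where
  K′ : ℕ
  K′ = 4 * K + 2 * K * (2 * K) * (4 * K * suc ℓ)
  ℓ-nonZero : NonZero ℓ
  ℓ-nonZero = >-nonZero (≤-trans (s≤s z≤n) 2≤ℓ)
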